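{- Let $G$ be a connected graph of order $n\ge2$ and $v\in V(G)$ a vertex not adjacent to any vertex of degree $1$. Then $$\gamma_t(M(G\setminus v))\le \gamma_t(M(G)) \le \gamma_t(M(G\setminus v))+1.$$
   Context: All graphs are finite and simple. $G\setminus v$ denotes the subgraph of $G$ induced on $V(G)\setminus\{v\}$. For a graph $H$ with no isolated vertices, a total dominating set of $H$ is a set $S\subseteq V(H)$ such that every vertex of $H$ has at least one neighbor in $S$; $\gamma_t(H)$ is the minimum cardinality of a total dominating set. The middle graph $M(G)$ of a graph $G$ has vertex set $V(G)\cup E(G)$ (disjoint union), and two of its vertices $x,y$ are adjacent exactly when either $x,y\in E(G)$ are edges of $G$ sharing a common endpoint, or $x\in V(G)$, $y\in E(G)$ and $x$ is an endpoint of $y$ (no two elements of $V(G)$ are adjacent in $M(G)$). -}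

module Defs where

open import Data.Nat using (ℕ; suc; _≤_; _+_)
open import Data.Fin using (Fin; punchIn) renaming (_<_ to _<ᶠ_)
open import Data.Fin.Properties using (punchIn-injective)
open import Data.Bool using (Bool; true; false)
open import Data.List using (List; length; filterᵇ; allFin)
open import Data.List.Membership.Propositional using (_∈_)
open import Data.List.Relation.Unary.Unique.Propositional using (Unique)
open import Data.Product using (Σ; ∃; _×_; _,_; proj₁; proj₂)
open import Data.Sum using (_⊎_; inj₁; inj₂)
open import Data.Empty using (⊥)
open import Relation.Binary.PropositionalEquality using (_≡_; _≢_)

record Graph (n : ℕ) : Set where
  field
    adj    : Fin n → Fin n → Bool
    sym    : ∀ i j → adj i j ≡ adj j i
    irrefl : ∀ i → adj i i ≡ false
open Graph public

degree : ∀ {n} → Graph n → Fin n → ℕ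
degree G i = length (filterᵇ (adj G i) (allFin _))

data Walk {n : ℕ} (G : Graph n) : Fin n → Fin n → Set where
  here : ∀ {i} → Walk G i i
  step : ∀ {i j k} → adj G i j ≡ true → Walk G j k → Walk G i k

Connected : ∀ {n} → Graph n → Set
Connected G = ∀ i j → Walk G i j

-- vertex deletion G ∖ v : vertices of Fin n other than v, enumerated
-- via punchIn v : Fin n → Fin (suc n) (the order-preserving injection
-- that skips v); the induced subgraph on them.
delete : ∀ {n} → Graph (suc n) → Fin (suc n) → Graph n
delete G v = record
  { adj    = λ i j → adj G (punchIn v i) (punchIn v j)
  ; sym    = λ i j → sym G (punchIn v i) (punchIn v j)
  ; irrefl = λ i → irrefl G (punchIn v i)
  }

-- Edges of G: pairs (i , j) with i < j and i ~ j (each edge once).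

Edge : ∀ {n} → Graph n → Set
Edge {n} G = Σ (Fin n × Fin n) λ p → (proj₁ p <ᶠ proj₂ p) × (adj G (proj₁ p) (proj₂ p) ≡ true)

_isEndOf_ : ∀ {n} {G : Graph n} → Fin n → Edge G → Set
x isEndOf ((i , j) , _) = (x ≡ i) ⊎ (x ≡ j)

-- the middle graph M(G): vertex set V(G) ⊎ E(G)
MVertex : ∀ {n} → Graph n → Set
MVertex {n} G = Fin n ⊎ Edge G

MAdj : ∀ {n} (G : Graph n) → MVertex G → MVertex G → Set
MAdj G (inj₁ x) (inj₁ y) = ⊥
MAdj G (inj₁ x) (inj₂ e) = _isEndOf_ {G = G} x e
MAdj G (inj₂ e) (inj₁ x) = _isEndOf_ {G = G} x e
MAdj G (inj₂ e) (inj₂ f) =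
  (proj₁ e ≢ proj₁ f) × ∃ λ x → (_isEndOf_ {G = G} x e) × (_isEndOf_ {G = G} x f)

-- Total domination for a graph given by a vertex type V and an
-- adjacency relation.  A vertex subset is a duplicate-free list.

IsTDS : {V : Set} → (V → V → Set) → List V → Set
IsTDS {V} A S = ∀ (x : V) → ∃ λ y → (y ∈ S) × A x y

IsγT : {V : Set} → (V → V → Set) → ℕ → Set
IsγT {V} A k =
  (∃ λ (S : List V) → Unique S × IsTDS A S × length S ≡ k)
  × (∀ (S : List V) → Unique S → IsTDS A S → k ≤ length S)

-- Write H = G ∖ v and call an edge vx of G a spoke.
-- Upper bound: a total dominating set S of M(H), carried over to M(G), together with one spoke vu
-- dominates M(G): the vertex v is dominated by vu, and any spoke vx by the edge of S dominating x.
-- Lower bound: a total dominating set T of M(G) is mapped into M(H) without growing. Vertices and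
-- edges avoiding v are kept; a spoke vx becomes the vertex x if T already has an edge at x avoiding v,
-- and otherwise an edge x w of H, which exists because x is not a leaf. The only collision to avoid is
-- two such x, w choosing each other: then the larger one becomes a vertex instead.

module Submission where

open import Defs hiding (sym)
open import Data.Nat using (ℕ; zero; suc; _≤_; _+_)
open import Data.Nat.Properties using (≤-trans; +-comm; <⇒≤)
import Data.Fin as Fin
open import Data.Fin using (Fin; punchIn; punchOut) renaming (_<_ to _<ᶠ_)
open import Data.Fin.Properties
  using (_≟_; _<?_; <-cmp; <-irrefl; <-asym; <-irrelevant; <⇒≢; ≤∧≢⇒<; 0≢1+n; suc-injective;
         punchIn-injective; punchIn-mono-≤; punchInᵢ≢i; punchIn-punchOut; any?)
open import Data.Bool using (Bool; true; false)
open import Data.Bool.Properties using () renaming (_≟_ to _≟ᵇ_)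
open import Data.List using (List; _∷_; length; map; tabulate; filterᵇ; deduplicate)
open import Data.List.Properties using (length-map; length-deduplicate)
open import Data.List.Relation.Unary.Any using (Any; here; there)
import Data.List.Relation.Unary.Any as Any
open import Data.List.Membership.Propositional using (_∈_; find; lose)
open import Data.List.Membership.Propositional.Properties using (∈-map⁺; ∈-deduplicate⁺)
open import Data.List.Relation.Unary.Unique.DecPropositional.Properties using (deduplicate-!)
open import Data.Product using (Σ-syntax; ∃; _×_; _,_; proj₁; proj₂)
open import Data.Product.Properties using () renaming (≡-dec to ×-≡-dec)
open import Data.Sum using (_⊎_; inj₁; inj₂; swap)
open import Data.Sum.Properties using () renaming (≡-dec to ⊎-≡-dec)
open import Data.Empty using (⊥; ⊥-elim)
open import Function using (_∘_)
open import Relation.Nullary using (¬_; Dec; yes; no)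
open import Relation.Nullary.Decidable using (map′; _×-dec_; _⊎-dec_; ¬?)
open import Relation.Binary using (DecidableEquality; tri<; tri≈; tri>)
open import Relation.Binary.PropositionalEquality
open import Axiom.UniquenessOfIdentityProofs using (module Decidable⇒UIP)

γt-≤-length : ∀ {V : Set} {A : V → V → Set} {k} → DecidableEquality V →
              IsγT A k → (S : List V) → IsTDS A S → k ≤ length S
γt-≤-length {A = A} _≟ᵥ_ (_ , minimal) S dom =
  ≤-trans (minimal (deduplicate _≟ᵥ_ S) (deduplicate-! _≟ᵥ_ S) dom′) (length-deduplicate _≟ᵥ_ S)
  where
    dom′ : IsTDS A (deduplicate _≟ᵥ_ S)
    dom′ x = let y , y∈S , xy = dom x in y , ∈-deduplicate⁺ _≟ᵥ_ y∈S , xy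

module _ {A : Set} (p : A → Bool) where

  length-filterᵇ-none : ∀ {n} (f : Fin n → A) → (∀ i → p (f i) ≢ true) →
                        length (filterᵇ p (tabulate f)) ≡ 0
  length-filterᵇ-none {zero}  f none = refl
  length-filterᵇ-none {suc n} f none with p (f Fin.zero) in eq
  ... | true  = ⊥-elim (none Fin.zero eq)
  ... | false = length-filterᵇ-none (f ∘ Fin.suc) (none ∘ Fin.suc)

  length-filterᵇ-unique : ∀ {n} (f : Fin n → A) (k : Fin n) → p (f k) ≡ true →
                          (∀ i → p (f i) ≡ true → i ≡ k) → length (filterᵇ p (tabulate f)) ≡ 1
  length-filterᵇ-unique f Fin.zero pk unique with p (f Fin.zero)
  ... | true  = cong suc (length-filterᵇ-none (f ∘ Fin.suc) (λ i → 0≢1+n ∘ sym ∘ unique (Fin.suc i)))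
  length-filterᵇ-unique f Fin.zero () unique | false
  length-filterᵇ-unique f (Fin.suc k) pk unique with p (f Fin.zero) in eq
  ... | true  = ⊥-elim (0≢1+n (unique Fin.zero eq))
  ... | false = length-filterᵇ-unique (f ∘ Fin.suc) k pk (λ i → suc-injective ∘ unique (Fin.suc i))

module _ {n : ℕ} (K : Graph n) where

  adj⇒≢ : ∀ {a b} → adj K a b ≡ true → a ≢ b
  adj⇒≢ {a} ab refl with trans (sym ab) (irrefl K a)
  ... | ()

  degree-≡1 : ∀ {x y} → adj K x y ≡ true → (∀ z → adj K x z ≡ true → z ≡ y) → degree K x ≡ 1
  degree-≡1 {x} {y} xy only = length-filterᵇ-unique (adj K x) (λ i → i) y xy only

  data Joins : Edge K → Fin n → Fin n → Set where
    forward  : ∀ {i j p} → Joins ((i , j) , p) i j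
    backward : ∀ {i j p} → Joins ((i , j) , p) j i

  joins-sym : ∀ {e a b} → Joins e a b → Joins e b a
  joins-sym forward  = backward
  joins-sym backward = forward

  joins-adj : ∀ {e a b} → Joins e a b → adj K a b ≡ true
  joins-adj (forward  {p = _ , ij})           = ij
  joins-adj (backward {i} {j} {p = _ , ij}) = trans (Graph.sym K j i) ij

  joins-≢ : ∀ {e a b} → Joins e a b → a ≢ b
  joins-≢ = adj⇒≢ ∘ joins-adj

  joins-end : ∀ {e a b} → Joins e a b → _isEndOf_ {G = K} a e
  joins-end forward  = inj₁ refl
  joins-end backward = inj₂ refl

  end-joins : ∀ {e a} → _isEndOf_ {G = K} a e → ∃ (Joins e a)
  end-joins (inj₁ refl) = _ , forward
  end-joins (inj₂ refl) = _ , backward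

  joins-end-cases : ∀ {e a b z} → Joins e a b → _isEndOf_ {G = K} z e → z ≡ a ⊎ z ≡ b
  joins-end-cases forward  z∈e = z∈e
  joins-end-cases backward z∈e = swap z∈e

  joins-ends : ∀ {e a b c d} → Joins e a b → Joins e c d → (a ≡ c × b ≡ d) ⊎ (a ≡ d × b ≡ c)
  joins-ends forward  forward  = inj₁ (refl , refl)
  joins-ends forward  backward = inj₂ (refl , refl)
  joins-ends backward forward  = inj₂ (refl , refl)
  joins-ends backward backward = inj₁ (refl , refl)

  joins-functional : ∀ {e a b c} → Joins e a b → Joins e a c → b ≡ c
  joins-functional jb jc with joins-ends jb jc
  ... | inj₁ (_ , b≡c)   = b≡c
  ... | inj₂ (a≡c , _)   = ⊥-elim (joins-≢ jc a≡c)

  joins-ends-unique : ∀ {e f a b} → Joins e a b → Joins f a b → proj₁ e ≡ proj₁ f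
  joins-ends-unique forward  forward  = refl
  joins-ends-unique backward backward = refl
  joins-ends-unique (forward {p = a<b , _}) (backward {p = b<a , _}) = ⊥-elim (<-asym a<b b<a)
  joins-ends-unique (backward {p = b<a , _}) (forward {p = a<b , _}) = ⊥-elim (<-asym a<b b<a)

  edge-ext : ∀ {e f : Edge K} → proj₁ e ≡ proj₁ f → e ≡ f
  edge-ext {_ , i<j , ij} {_ , i<j′ , ij′} refl =
    cong₂ (λ l a → _ , l , a) (<-irrelevant i<j i<j′) (Decidable⇒UIP.≡-irrelevant _≟ᵇ_ ij ij′)

  joins-injective : ∀ {e f a b} → Joins e a b → Joins f a b → e ≡ f
  joins-injective je jf = edge-ext (joins-ends-unique je jf)

  edge-between : ∀ {a b} → adj K a b ≡ true → Σ[ e ∈ Edge K ] Joins e a b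
  edge-between {a} {b} ab with <-cmp a b
  ... | tri< a<b _ _ = ((a , b) , a<b , ab) , forward
  ... | tri≈ _ a≡b _ = ⊥-elim (adj⇒≢ ab a≡b)
  ... | tri> _ _ b<a = ((b , a) , b<a , trans (Graph.sym K b a) ab) , backward

  edges-adjacent : ∀ {e f a b c} → Joins e a b → Joins f a c → b ≢ c → MAdj K (inj₂ e) (inj₂ f)
  edges-adjacent {a = a} je jf b≢c =
    (λ e≡f → b≢c (joins-functional (subst (λ g → Joins g a _) (edge-ext e≡f) je) jf)) ,
    a , joins-end je , joins-end jf

  edges-adjacent-inv : ∀ {e f a b} → MAdj K (inj₂ e) (inj₂ f) → Joins e a b →
                       (∃ λ c → Joins f a c × c ≢ b) ⊎ (∃ λ c → Joins f b c × c ≢ a)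
  edges-adjacent-inv (e≢f , z , z∈e , z∈f) je with end-joins z∈f | joins-end-cases je z∈e
  ... | c , jf | inj₁ refl = inj₁ (c , jf , λ { refl → e≢f (joins-ends-unique je jf) })
  ... | c , jf | inj₂ refl = inj₂ (c , jf , λ { refl → e≢f (joins-ends-unique (joins-sym je) jf) })

  _≟ₘ_ : DecidableEquality (MVertex K)
  _≟ₘ_ = ⊎-≡-dec _≟_ λ e f → map′ edge-ext (cong proj₁) (×-≡-dec _≟_ _≟_ (proj₁ e) (proj₁ f))

  joins? : ∀ e a b → Dec (Joins e a b)
  joins? e@((i , j) , _) a b = map′ from to ((i ≟ a ×-dec j ≟ b) ⊎-dec (i ≟ b ×-dec j ≟ a))
    where
      from : (i ≡ a × j ≡ b) ⊎ (i ≡ b × j ≡ a) → Joins e a b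
      from (inj₁ (refl , refl)) = forward
      from (inj₂ (refl , refl)) = backward
      to : Joins e a b → (i ≡ a × j ≡ b) ⊎ (i ≡ b × j ≡ a)
      to forward  = inj₁ (refl , refl)
      to backward = inj₂ (refl , refl)

module Deletion {n : ℕ} (G : Graph (suc n)) (v : Fin (suc n)) where

  H : Graph n
  H = delete G v

  ↑_ : Fin n → Fin (suc n)
  ↑_ = punchIn v

  ↑-injective : ∀ {x y} → ↑ x ≡ ↑ y → x ≡ y
  ↑-injective = punchIn-injective v _ _

  ↑-mono-< : ∀ {x y} → x <ᶠ y → ↑ x <ᶠ ↑ y
  ↑-mono-< x<y = ≤∧≢⇒< (punchIn-mono-≤ v _ _ (<⇒≤ x<y)) (<⇒≢ x<y ∘ ↑-injective)

  ↑≢v : ∀ x → ↑ x ≢ v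
  ↑≢v = punchInᵢ≢i v

  data Location (y : Fin (suc n)) : Set where
    centre  : v ≡ y → Location y
    shifted : ∀ x → ↑ x ≡ y → Location y

  locate : ∀ y → Location y
  locate y with v ≟ y
  ... | yes v≡y = centre v≡y
  ... | no v≢y  = shifted (punchOut v≢y) (punchIn-punchOut v≢y)

  data EdgeLocation (f : Edge G) : Set where
    spoke : ∀ x → Joins G f v (↑ x) → EdgeLocation f
    away  : ∀ a c → Joins G f (↑ a) (↑ c) → EdgeLocation f

  locate-edge : ∀ f → EdgeLocation f
  locate-edge f@((i , j) , i<j , _) with locate i | locate j
  ... | centre refl    | centre refl    = ⊥-elim (<-irrefl refl i<j)
  ... | centre refl    | shifted y refl = spoke y forward
  ... | shifted x refl | centre refl    = spoke x backward
  ... | shifted x refl | shifted y refl = away x y forward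

  lift : Edge H → Edge G
  lift ((i , j) , i<j , ij) = (↑ i , ↑ j) , ↑-mono-< i<j , ij

  joins-lift : ∀ {e a b} → Joins H e a b → Joins G (lift e) (↑ a) (↑ b)
  joins-lift forward  = forward
  joins-lift backward = backward

  lift-onto : ∀ {f a b} → Joins G f (↑ a) (↑ b) → Σ[ e ∈ Edge H ] lift e ≡ f
  lift-onto jf = let e , je = edge-between H (joins-adj G jf) in e , joins-injective G (joins-lift je) jf

  up : MVertex H → MVertex G
  up (inj₁ x) = inj₁ (↑ x)
  up (inj₂ e) = inj₂ (lift e)

  end-lift : ∀ {x e} → _isEndOf_ {G = H} x e → _isEndOf_ {G = G} (↑ x) (lift e)
  end-lift (inj₁ x≡i) = inj₁ (cong ↑_ x≡i)
  end-lift (inj₂ x≡j) = inj₂ (cong ↑_ x≡j)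

  up-adj : ∀ s t → MAdj H s t → MAdj G (up s) (up t)
  up-adj (inj₁ _) (inj₂ e) x∈e = end-lift {e = e} x∈e
  up-adj (inj₂ e) (inj₁ _) x∈e = end-lift {e = e} x∈e
  up-adj (inj₂ e) (inj₂ f) (e≢f , x , x∈e , x∈f) =
    (λ eq → e≢f (cong₂ _,_ (↑-injective (cong proj₁ eq)) (↑-injective (cong proj₂ eq)))) ,
    ↑ x , end-lift {e = e} x∈e , end-lift {e = f} x∈f

  extend-TDS : ∀ {u} (vu : adj G v u ≡ true) {S} → IsTDS (MAdj H) S →
               IsTDS (MAdj G) (inj₂ (proj₁ (edge-between G vu)) ∷ map up S)
  extend-TDS vu {S} dom = dominated
    where
      S′ = inj₂ (proj₁ (edge-between G vu)) ∷ map up S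

      Dominated : MVertex G → Set
      Dominated s = ∃ λ t → t ∈ S′ × MAdj G s t

      from-H : ∀ s → Dominated (up s)
      from-H s = let t , t∈S , st = dom s in up t , there (∈-map⁺ up t∈S) , up-adj s t st

      spoke-dominated : ∀ {f} x → Joins G f v (↑ x) → Dominated (inj₂ f)
      spoke-dominated x jf with dom (inj₁ x)
      ... | inj₁ _ , _ , ()
      ... | inj₂ e , e∈S , x∈e =
        let y , je = end-joins H {e} x∈e
        in  inj₂ (lift e) , there (∈-map⁺ up e∈S) ,
            edges-adjacent G (joins-sym G jf) (joins-lift je) (↑≢v y ∘ sym)

      dominated : ∀ s → Dominated s
      dominated (inj₁ y) with locate y
      ... | centre refl    = inj₂ _ , here refl , joins-end G (proj₂ (edge-between G vu))
      ... | shifted x refl = from-H (inj₁ x)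
      dominated (inj₂ f) with locate-edge f
      ... | spoke x jf  = spoke-dominated x jf
      ... | away a c jf =
        let e , lift-e≡f = lift-onto jf in subst (Dominated ∘ inj₂) lift-e≡f (from-H (inj₂ e))

module LowerBound {n : ℕ} (G : Graph (suc (suc n))) (v : Fin (suc (suc n)))
                  (no-leaf-neighbour : ∀ u → adj G v u ≡ true → degree G u ≢ 1)
                  (T : List (MVertex G)) where

  open Deletion G v

  -- Only meaningful for neighbours of v; x itself is a junk value.
  partner : Fin (suc n) → Fin (suc n)
  partner x with any? (λ w → adj H x w ≟ᵇ true)
  ... | yes (w , _) = w
  ... | no _        = x

  partner-adj : ∀ {x} → adj G v (↑ x) ≡ true → adj H x (partner x) ≡ true
  partner-adj {x} vx with any? (λ w → adj H x w ≟ᵇ true)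
  ... | yes (_ , xw) = xw
  ... | no isolated  =
    ⊥-elim (no-leaf-neighbour (↑ x) vx (degree-≡1 G (trans (Graph.sym G (↑ x) v) vx) only-v))
    where
      only-v : ∀ z → adj G (↑ x) z ≡ true → z ≡ v
      only-v z xz with locate z
      ... | centre refl    = refl
      ... | shifted w refl = ⊥-elim (isolated (w , xz))

  AwayEdgeAt : Fin (suc n) → MVertex G → Set
  AwayEdgeAt x (inj₁ _) = ⊥
  AwayEdgeAt x (inj₂ f) = ∃ λ y → Joins G f (↑ x) (↑ y)

  SpokeTo : Fin (suc n) → MVertex G → Set
  SpokeTo x (inj₁ _) = ⊥
  SpokeTo x (inj₂ f) = Joins G f v (↑ x)

  Covered : Fin (suc n) → Set
  Covered x = Any (AwayEdgeAt x) T

  Spoked : Fin (suc n) → Set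
  Spoked x = Any (SpokeTo x) T

  -- x is the larger of two uncovered spoke ends choosing each other, so x is sent to its vertex.
  Mutual : Fin (suc n) → Set
  Mutual x = Spoked (partner x) × ¬ Covered (partner x) × partner (partner x) ≡ x × partner x <ᶠ x

  covered? : ∀ x → Dec (Covered x)
  covered? x = Any.any? away? T
    where
      away? : ∀ t → Dec (AwayEdgeAt x t)
      away? (inj₁ _) = no λ ()
      away? (inj₂ f) = any? λ y → joins? G f (↑ x) (↑ y)

  spoked? : ∀ x → Dec (Spoked x)
  spoked? x = Any.any? spoke? T
    where
      spoke? : ∀ t → Dec (SpokeTo x t)
      spoke? (inj₁ _) = no λ ()
      spoke? (inj₂ f) = joins? G f v (↑ x)

  mutual? : ∀ x → Dec (Mutual x)
  mutual? x = spoked? (partner x) ×-dec ¬? (covered? (partner x)) ×-dec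
              partner (partner x) ≟ x ×-dec partner x <? x

  mutual-tiebreak : ∀ {a b} → Spoked a → Spoked b → ¬ Covered a → ¬ Covered b →
                    partner a ≡ b → partner b ≡ a → ¬ Mutual a → ¬ Mutual b → a ≡ b
  mutual-tiebreak {a} sp-a sp-b ¬cov-a ¬cov-b refl pb≡a ¬mut-a ¬mut-b with <-cmp a (partner a)
  ... | tri< a<b _ _ = ⊥-elim (¬mut-b (subst Spoked (sym pb≡a) sp-a ,
                                       subst (¬_ ∘ Covered) (sym pb≡a) ¬cov-a ,
                                       cong partner pb≡a , subst (_<ᶠ partner a) (sym pb≡a) a<b))
  ... | tri≈ _ a≡b _ = a≡b
  ... | tri> _ _ b<a = ⊥-elim (¬mut-a (sp-b , ¬cov-b , pb≡a , b<a))

  spoke-image : ∀ x → adj G v (↑ x) ≡ true → MVertex H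
  spoke-image x vx with covered? x | mutual? x
  ... | no _ | no _ = inj₂ (proj₁ (edge-between H (partner-adj vx)))
  ... | _    | _    = inj₁ x

  data SpokeImage (x : Fin (suc n)) : MVertex H → Set where
    at-vertex    : Covered x ⊎ Mutual x → SpokeImage x (inj₁ x)
    partner-edge : ∀ {e} → ¬ Covered x → ¬ Mutual x → Joins H e x (partner x) → SpokeImage x (inj₂ e)

  spoke-image-spec : ∀ x vx → SpokeImage x (spoke-image x vx)
  spoke-image-spec x vx with covered? x | mutual? x
  ... | yes cov  | _       = at-vertex (inj₁ cov)
  ... | no _     | yes mut = at-vertex (inj₂ mut)
  ... | no ¬cov  | no ¬mut = partner-edge ¬cov ¬mut (proj₂ (edge-between H (partner-adj vx)))

  vertex-image : ∀ {y} → Location y → MVertex H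
  vertex-image (centre _)    = inj₁ Fin.zero  -- v has no counterpart in H
  vertex-image (shifted x _) = inj₁ x

  edge-image : ∀ {f} → EdgeLocation f → MVertex H
  edge-image (spoke x jf)  = spoke-image x (joins-adj G jf)
  edge-image (away a c jf) = inj₂ (proj₁ (edge-between H (joins-adj G jf)))

  image : MVertex G → MVertex H
  image (inj₁ y) = vertex-image (locate y)
  image (inj₂ f) = edge-image (locate-edge f)

  T′ : List (MVertex H)
  T′ = map image T

  vertex-image-↑ : ∀ {x} (l : Location (↑ x)) → vertex-image l ≡ inj₁ x
  vertex-image-↑ {x} (centre v≡↑x)    = ⊥-elim (↑≢v x (sym v≡↑x))
  vertex-image-↑     (shifted x′ ↑x′≡↑x) = cong inj₁ (↑-injective ↑x′≡↑x)

  edge-image-away : ∀ {f a c} → Joins G f (↑ a) (↑ c) → (l : EdgeLocation f) →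
                    ∃ λ e → edge-image l ≡ inj₂ e × Joins H e a c
  edge-image-away {a = a} {c} jf (spoke x jv) with joins-end-cases G jf (joins-end G jv)
  ... | inj₁ v≡↑a = ⊥-elim (↑≢v a (sym v≡↑a))
  ... | inj₂ v≡↑c = ⊥-elim (↑≢v c (sym v≡↑c))
  edge-image-away jf (away a′ c′ jf′) with proj₂ (edge-between H (joins-adj G jf′)) | joins-ends G jf′ jf
  ... | je | inj₁ (p , q) = _ , refl , subst₂ (Joins H _) (↑-injective p) (↑-injective q) je
  ... | je | inj₂ (p , q) = _ , refl , joins-sym H (subst₂ (Joins H _) (↑-injective p) (↑-injective q) je)

  edge-image-spoke : ∀ {f x} → Joins G f v (↑ x) → (l : EdgeLocation f) → SpokeImage x (edge-image l)
  edge-image-spoke jf (spoke x′ jf′) =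
    subst (λ z → SpokeImage z (spoke-image x′ _)) (↑-injective (joins-functional G jf′ jf))
          (spoke-image-spec x′ _)
  edge-image-spoke jf (away a c jf′) with joins-end-cases G jf′ (joins-end G jf)
  ... | inj₁ v≡↑a = ⊥-elim (↑≢v a (sym v≡↑a))
  ... | inj₂ v≡↑c = ⊥-elim (↑≢v c (sym v≡↑c))

  vertex-kept : ∀ {x} → inj₁ (↑ x) ∈ T → inj₁ x ∈ T′
  vertex-kept {x} x∈T = subst (_∈ T′) (vertex-image-↑ (locate (↑ x))) (∈-map⁺ image x∈T)

  away-kept : ∀ {f a c} → inj₂ f ∈ T → Joins G f (↑ a) (↑ c) → ∃ λ e → inj₂ e ∈ T′ × Joins H e a c
  away-kept {f} f∈T jf =
    let e , image≡e , je = edge-image-away jf (locate-edge f)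
    in  e , subst (_∈ T′) image≡e (∈-map⁺ image f∈T) , je

  spoke-kept : ∀ {x} → Spoked x → ∃ λ t → t ∈ T′ × SpokeImage x t
  spoke-kept sp with find sp
  ... | inj₁ _ , _ , ()
  ... | inj₂ f , f∈T , jf =
    edge-image (locate-edge f) , ∈-map⁺ image f∈T , edge-image-spoke jf (locate-edge f)

  Dominated : MVertex H → Set
  Dominated s = ∃ λ t → t ∈ T′ × MAdj H s t

  end-dominated : ∀ {e x y} → inj₂ e ∈ T′ → Joins H e x y → Dominated (inj₁ x)
  end-dominated e∈T′ je = _ , e∈T′ , joins-end H je

  covered-dominated : ∀ {x} → Covered x → Dominated (inj₁ x)
  covered-dominated cov with find cov
  ... | inj₁ _ , _ , ()
  ... | inj₂ f , f∈T , _ , jf = let _ , e∈T′ , je = away-kept f∈T jf in end-dominated e∈T′ je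

  mutual-dominated : ∀ {x} → Mutual x → Dominated (inj₁ x)
  mutual-dominated {x} (sp , ¬cov , pw≡x , w<x) with spoke-kept sp
  ... | _ , _ , at-vertex (inj₁ cov) = ⊥-elim (¬cov cov)
  ... | _ , _ , at-vertex (inj₂ (_ , _ , _ , pw<w)) =
    ⊥-elim (<-asym w<x (subst (_<ᶠ partner x) pw≡x pw<w))
  ... | _ , t∈T′ , partner-edge _ _ je = end-dominated t∈T′ (joins-sym H (subst (Joins H _ _) pw≡x je))

  spoke-dominated : ∀ {x t} → t ∈ T′ → SpokeImage x t → Dominated (inj₁ x)
  spoke-dominated _     (at-vertex (inj₁ cov)) = covered-dominated cov
  spoke-dominated _     (at-vertex (inj₂ mut)) = mutual-dominated mut
  spoke-dominated t∈T′ (partner-edge _ _ je)   = end-dominated t∈T′ je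

  module _ (T-dom : IsTDS (MAdj G) T) where

    vertex-dominated : ∀ x → Dominated (inj₁ x)
    vertex-dominated x with T-dom (inj₁ (↑ x))
    ... | inj₁ _ , _ , ()
    ... | inj₂ f , f∈T , x∈f with end-joins G {f} x∈f
    ...   | c , jf with locate c
    ...     | shifted y refl = let _ , e∈T′ , je = away-kept f∈T jf in end-dominated e∈T′ je
    ...     | centre refl    = let _ , t∈T′ , x-image = spoke-kept (lose f∈T (joins-sym G jf))
                               in  spoke-dominated t∈T′ x-image

    partner-blocked : ∀ {e a b} → Joins H e a b → Spoked a → ¬ Covered a → ¬ Mutual a →
                      partner a ≡ b → Dominated (inj₂ e)
    partner-blocked {a = a} {b} je sp-a ¬cov-a ¬mut-a pa≡b with T-dom (inj₁ (↑ b))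
    ... | inj₁ _ , _ , ()
    ... | inj₂ h , h∈T , b∈h with end-joins G {h} b∈h
    ...   | c , jh with locate c
    ...     | shifted z refl with z ≟ a
    ...       | yes refl = ⊥-elim (¬cov-a (lose h∈T (b , joins-sym G jh)))
    ...       | no z≢a   = let e′ , e′∈T′ , je′ = away-kept h∈T jh
                           in  inj₂ e′ , e′∈T′ , edges-adjacent H (joins-sym H je) je′ (z≢a ∘ sym)
    partner-blocked {a = a} {b} je sp-a ¬cov-a ¬mut-a pa≡b | inj₂ h , h∈T , _ | c , jh | centre refl
      with spoke-kept (lose h∈T (joins-sym G jh))
    ... | t , t∈T′ , at-vertex _ = t , t∈T′ , joins-end H (joins-sym H je)
    ... | t , t∈T′ , partner-edge ¬cov-b ¬mut-b je′ with partner b ≟ a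
    ...   | no pb≢a  = t , t∈T′ , edges-adjacent H (joins-sym H je) je′ (pb≢a ∘ sym)
    ...   | yes pb≡a = ⊥-elim (joins-≢ H je (mutual-tiebreak sp-a (lose h∈T (joins-sym G jh))
                                               ¬cov-a ¬cov-b pa≡b pb≡a ¬mut-a ¬mut-b))

    dominated-through : ∀ {e a b g c} → Joins H e a b → inj₂ g ∈ T → Joins G g (↑ a) c → c ≢ ↑ b →
                        Dominated (inj₂ e)
    dominated-through {a = a} {b} {c = c} je g∈T jg c≢↑b with locate c
    ... | shifted c′ refl = let e′ , e′∈T′ , je′ = away-kept g∈T jg
                            in  inj₂ e′ , e′∈T′ , edges-adjacent H je je′ (c≢↑b ∘ cong ↑_ ∘ sym)
    ... | centre refl with spoke-kept (lose g∈T (joins-sym G jg))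
    ...   | t , t∈T′ , at-vertex _ = t , t∈T′ , joins-end H je
    ...   | t , t∈T′ , partner-edge ¬cov ¬mut je′ with partner a ≟ b
    ...     | no pa≢b  = t , t∈T′ , edges-adjacent H je je′ (pa≢b ∘ sym)
    ...     | yes pa≡b = partner-blocked je (lose g∈T (joins-sym G jg)) ¬cov ¬mut pa≡b

    edge-dominated : ∀ e → Dominated (inj₂ e)
    edge-dominated e@((a , b) , _) with T-dom (inj₂ (lift e))
    ... | inj₁ z , z∈T , z∈e with joins-end-cases G (joins-lift {e} forward) z∈e
    ...   | inj₁ refl = inj₁ a , vertex-kept z∈T , joins-end H {e} forward
    ...   | inj₂ refl = inj₁ b , vertex-kept z∈T , joins-end H {e} backward
    edge-dominated e | inj₂ g , g∈T , e∼g with edges-adjacent-inv G e∼g (joins-lift {e} forward)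
    ... | inj₁ (c , jg , c≢↑b) = dominated-through forward g∈T jg c≢↑b
    ... | inj₂ (c , jg , c≢↑a) = dominated-through backward g∈T jg c≢↑a

    image-TDS : IsTDS (MAdj H) T′
    image-TDS (inj₁ x) = vertex-dominated x
    image-TDS (inj₂ e) = edge-dominated e

γt-≤-delete-suc : ∀ {n} (G : Graph (suc n)) v {u} → adj G v u ≡ true →
                  ∀ {a b} → IsγT (MAdj (delete G v)) a → IsγT (MAdj G) b → b ≤ suc a
γt-≤-delete-suc G v vu ((S , _ , S-dom , refl) , _) γG =
  subst (λ k → _ ≤ suc k) (length-map up S) (γt-≤-length (_≟ₘ_ G) γG _ (extend-TDS vu S-dom))
  where open Deletion G v

γt-delete-≤ : ∀ {n} (G : Graph (suc (suc n))) v → (∀ u → adj G v u ≡ true → degree G u ≢ 1) →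
              ∀ {a b} → IsγT (MAdj (delete G v)) a → IsγT (MAdj G) b → a ≤ b
γt-delete-≤ G v no-leaf-neighbour γH ((T , _ , T-dom , refl) , _) =
  subst (_ ≤_) (length-map image T) (γt-≤-length (_≟ₘ_ (delete G v)) γH T′ (image-TDS T-dom))
  where open LowerBound G v no-leaf-neighbour T

walk-first-step : ∀ {n} {K : Graph n} {i j} → Walk K i j → i ≢ j → ∃ λ u → adj K i u ≡ true
walk-first-step here       i≢i = ⊥-elim (i≢i refl)
walk-first-step (step iu _) _  = _ , iu

connected-neighbour : ∀ {n} {G : Graph (suc (suc n))} → Connected G → ∀ v → ∃ λ u → adj G v u ≡ true
connected-neighbour connected Fin.zero    = walk-first-step (connected Fin.zero (Fin.suc Fin.zero)) 0≢1+n
connected-neighbour connected (Fin.suc v) =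
  walk-first-step (connected (Fin.suc v) Fin.zero) (0≢1+n ∘ sym)

lemma2p2 : ∀ (m : ℕ) (G : Graph (suc (suc m))) (v : Fin (suc (suc m)))
           → Connected G
           → (∀ u → adj G v u ≡ true → degree G u ≢ 1)
           → ∀ (a b : ℕ)
           → IsγT (MAdj (delete G v)) a
           → IsγT (MAdj G) b
           → (a ≤ b) × (b ≤ a + 1)
lemma2p2 m G v connected no-leaf-neighbour a b γH γG =
  γt-delete-≤ G v no-leaf-neighbour γH γG ,
  subst (b ≤_) (+-comm 1 a) (γt-≤-delete-suc G v (proj₂ (connected-neighbour connected v)) γH γG)
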